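{- Let $t<k$ be positive integers and $2\le v_1\le v_2\le\cdots\le v_k$ integers. If $v_i=v_{i+1}=\cdots=v_{k-t}=v_{k-t+1}$ for some $i\in\{1,2,\dots,k-t\}$, then $$(\bar{1},t)\text{ -LAN}(k,(v_1,\dots,v_k))\ge \left\lceil \frac{2\sum_{i\le j_1<\cdots<j_t\le k}\prod_{s=1}^{t} v_{j_s}}{1+\binom{k-i+1}{t}}\right\rceil.$$
   Context: Let $k,t,N$ be positive integers with $t<k$. For positive integers $v_1,\dots,v_k$, consider $N\times k$ arrays $A=(a_{rj})$ whose $j$-th column has entries from a fixed set $V_j$ with $|V_j|=v_j$. A $t$-way interaction is a set $T=\{(j,\sigma_j): j\in I\}$ with $I\subseteq\{1,\dots,k\}$, $|I|=t$, $\sigma_j\in V_j$. Let $\rho(A,T)$ be the set of row indices $r$ with $a_{rj}=\sigma_j$ for all $j\in I$, and $\rho(A,\mathcal T)=\bigcup_{T\in\mathcal T}\rho(A,T)$. $A$ is a $(\bar 1,t)$-LA$(N;k,(v_1,\dots,v_k))$ if for all sets $\mathcal T_1,\mathcal T_2$ of $t$-way interactions with $|\mathcal T_1|\le1$, $|\mathcal T_2|\le1$: $\rho(A,\mathcal T_1)=\rho(A,\mathcal T_2)\iff \mathcal T_1=\mathcal T_2$ (equivalently: every $t$-way interaction occurs in some row, and distinct $t$-way interactions have distinct $\rho$). $(\bar1,t)$-LAN$(k,(v_1,\dots,v_k))$ is the minimum $N$ for which such an array exists. -}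

module Defs where

open import Data.Nat using (ℕ; zero; suc; _+_; _*_; _∸_; _≤_; _<_)
open import Data.Nat.DivMod using (_/_)
open import Data.Fin using (Fin; toℕ)
open import Data.Fin.Subset using (Subset; ∣_∣)
open import Data.Maybe using (Maybe; just; nothing; is-just)
open import Data.List using (List; []; _∷_; map; filterᵇ; length; _++_)
open import Data.Nat.ListAction using (sum; product)
open import Data.List using (allFin)
open import Data.Vec using (tabulate)
open import Data.Product using (_×_)
open import Relation.Binary.PropositionalEquality using (_≡_)

-- Columns are indexed by Fin k (0-based); column j takes values in
-- V_j = Fin (v j), a fixed set of size v j.

Array : (N k : ℕ) → (Fin k → ℕ) → Set
Array N k v = Fin N → (j : Fin k) → Fin (v j)

-- A partial assignment of values to columns: τ j = just σ_j if column j
-- belongs to the interaction with value σ_j, and nothing otherwise.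
PartialAssignment : (k : ℕ) → (Fin k → ℕ) → Set
PartialAssignment k v = (j : Fin k) → Maybe (Fin (v j))

support : ∀ {k v} → PartialAssignment k v → Subset k
support τ = tabulate (λ j → is-just (τ j))

IsInteraction : ∀ {k v} → ℕ → PartialAssignment k v → Set
IsInteraction t τ = ∣ support τ ∣ ≡ t

SameInteraction : ∀ {k v} → PartialAssignment k v → PartialAssignment k v → Set
SameInteraction τ τ' = ∀ j → τ j ≡ τ' j

InRho : ∀ {N k v} → Array N k v → PartialAssignment k v → Fin N → Set
InRho A τ r = ∀ j x → τ j ≡ just x → A r j ≡ x

-- A set 𝒯 of t-way interactions with |𝒯| ≤ 1: either empty (nothing)
-- or a singleton {T} (just T).
InRhoSet : ∀ {N k v} → Array N k v → Maybe (PartialAssignment k v) → Fin N → Set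
InRhoSet A nothing  r = Data.Empty.⊥
  where import Data.Empty
InRhoSet A (just τ) r = InRho A τ r

SameSet : ∀ {k v} → Maybe (PartialAssignment k v) → Maybe (PartialAssignment k v) → Set
SameSet nothing  nothing   = Data.Unit.⊤
  where import Data.Unit
SameSet nothing  (just _)  = Data.Empty.⊥
  where import Data.Empty
SameSet (just _) nothing   = Data.Empty.⊥
  where import Data.Empty
SameSet (just τ) (just τ') = SameInteraction τ τ'

AllInteractions : ∀ {k v} → ℕ → Maybe (PartialAssignment k v) → Set
AllInteractions t nothing  = Data.Unit.⊤
  where import Data.Unit
AllInteractions t (just τ) = IsInteraction t τ

SameRows : ∀ {N k v} → Array N k v → (𝒯₁ 𝒯₂ : Maybe (PartialAssignment k v)) → Set
SameRows A 𝒯₁ 𝒯₂ = ∀ r → (InRhoSet A 𝒯₁ r → InRhoSet A 𝒯₂ r) × (InRhoSet A 𝒯₂ r → InRhoSet A 𝒯₁ r)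

IsLA1bar : (t N k : ℕ) (v : Fin k → ℕ) → Array N k v → Set
IsLA1bar t N k v A =
  ∀ (𝒯₁ 𝒯₂ : Maybe (PartialAssignment k v)) →
    AllInteractions t 𝒯₁ → AllInteractions t 𝒯₂ →
    (SameRows A 𝒯₁ 𝒯₂ → SameSet 𝒯₁ 𝒯₂) × (SameSet 𝒯₁ 𝒯₂ → SameRows A 𝒯₁ 𝒯₂)

-- All sublists (subsequences) of a list; a sublist of length t of
-- [x_i, …, x_k] corresponds to a choice of indices i ≤ j₁ < ⋯ < j_t ≤ k.
sublists : List ℕ → List (List ℕ)
sublists []       = [] ∷ []
sublists (x ∷ xs) = map (x ∷_) (sublists xs) ++ sublists xs

sumProdChoose : ℕ → List ℕ → ℕ
sumProdChoose t xs = sum (map product (filterᵇ (λ ys → length ys Data.Nat.≡ᵇ t) (sublists xs)))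
  where import Data.Nat

-- The list [v_i, …, v_k] (0-based: columns j with i ≤ toℕ j).
valuesFrom : ∀ {k} → (Fin k → ℕ) → ℕ → List ℕ
valuesFrom {k} v i = map v (filterᵇ (λ j → i Data.Nat.≤ᵇ toℕ j) (allFin k))
  where import Data.Nat

⌈_/suc_⌉ : ℕ → ℕ → ℕ
⌈ a /suc b ⌉ = (a + b) / suc b

module Submission where

-- Double counting over pairs (T, r) of a t-way interaction T on the columns from i on and a
-- row r, weighted by [r covers T] + [ρ(T) = {r}].  Every T is covered by some row, and if
-- only by r then ρ(T) = {r}; so each T has total weight at least 2.  A row covers at most
-- C(k − i, t) of these interactions, and since distinct interactions have distinct ρ, it is
-- the only covering row of at most one of them; so each row has total weight at most
-- C(k − i, t) + 1.  The number of interactions is the sum of products in the bound.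

open import Defs
open import Data.Nat using (ℕ; _+_; _*_; _∸_; _≤_; _<_)
open import Data.Nat.Combinatorics using (_C_)
open import Data.Fin using (Fin; toℕ)
open import Relation.Binary.PropositionalEquality using (_≡_)

open import Data.Nat.Properties hiding (suc-injective; _≟_; 0≢1+n)
import Data.Nat.Properties as ℕ

open import Algebra.Properties.CommutativeMonoid.Sum +-0-commutativeMonoid
  using (sum; sum-syntax; sum-cong-≗; sum-replicate-zero; ∑-distrib-+; ∑-comm)
open import Algebra.Properties.CommutativeSemigroup +-commutativeSemigroup using (interchange)
open import Data.Bool using (Bool; true; false)
open import Data.Empty using (⊥; ⊥-elim)
open import Data.Unit using (tt)
open import Data.Fin using (zero; suc; _≟_)
open import Data.Fin.Properties using (all?; suc-injective; 0≢1+n)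
open import Data.Fin.Subset using (∣_∣)
open import Data.List using (List; []; _∷_; map; filterᵇ; length; _++_; allFin; tabulate)
open import Data.List.Properties using (filter-++; map-++)
open import Data.List.Relation.Unary.All using (All; []; _∷_; universal)
open import Data.List.Relation.Unary.AllPairs using (_∷_)
open import Data.List.Relation.Unary.Unique.Propositional using (Unique)
open import Data.List.Relation.Unary.Unique.Propositional.Properties using (filter⁺; allFin⁺)
open import Data.Maybe using (just; nothing; is-just)
open import Data.Maybe.Properties using (just-injective)
open import Data.Nat using (zero; suc; z≤n; s≤s; z<s; _≤ᵇ_; _≡ᵇ_)
open import Data.Nat.Combinatorics using (nCk+nC[k+1]≡[n+1]C[k+1])
open import Data.Nat.DivMod using (m<n*o⇒m/o<n)
open import Data.Nat.ListAction using (product) renaming (sum to sumList)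
open import Data.Nat.ListAction.Properties using (sum-++)
open import Data.Product using (_×_; _,_; proj₁; ∃-syntax)
open import Data.Sum using (_⊎_; inj₁; inj₂)
open import Data.Vec using () renaming (tabulate to tabulateᵥ)
open import Data.Vec.Properties using (tabulate-cong)
open import Function using (_∘_)
open import Relation.Nullary using (Dec; yes; no; _×-dec_)
open import Relation.Nullary.Decidable using (T?)
open import Relation.Nullary.Reflects using (ofʸ; ofⁿ)
open import Relation.Binary.PropositionalEquality using (refl; sym; trans; cong; cong₂; subst; _≢_; module ≡-Reasoning)

0<m+n⇒0<m⊎0<n : ∀ m {n} → 0 < m + n → 0 < m ⊎ 0 < n
0<m+n⇒0<m⊎0<n zero    0<n = inj₂ 0<n
0<m+n⇒0<m⊎0<n (suc m) _   = inj₁ z<s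

m+n≤1 : ∀ {m n} → m ≤ 1 → n ≤ 1 → (0 < m → 0 < n → ⊥) → m + n ≤ 1
m+n≤1 {zero}                _        n≤1 _    = n≤1
m+n≤1 {suc zero}    {zero}  _        _   _    = ≤-refl
m+n≤1 {suc zero}    {suc n} _        _   both = ⊥-elim (both z<s z<s)
m+n≤1 {suc (suc m)}         (s≤s ()) _   _

∑-mono-≤ : ∀ {n} {f g : Fin n → ℕ} → (∀ x → f x ≤ g x) → sum f ≤ sum g
∑-mono-≤ {zero}  f≤g = z≤n
∑-mono-≤ {suc n} f≤g = +-mono-≤ (f≤g zero) (∑-mono-≤ (f≤g ∘ suc))

∑-const : ∀ n a → ∑[ x < n ] a ≡ n * a
∑-const zero    a = refl
∑-const (suc n) a = cong (a +_) (∑-const n a)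

∑-zero : ∀ {n} {f : Fin n → ℕ} → (∀ x → f x ≡ 0) → sum f ≡ 0
∑-zero {n} f≡0 = trans (sum-cong-≗ f≡0) (sum-replicate-zero n)

∑-single : ∀ {n} (f : Fin n → ℕ) x₀ → (∀ x → x ≢ x₀ → f x ≡ 0) → sum f ≡ f x₀
∑-single f zero     f≡0 = trans (cong (f zero +_) (∑-zero (λ x → f≡0 (suc x) λ ()))) (+-identityʳ _)
∑-single f (suc x₀) f≡0 =
  trans (cong (_+ sum (f ∘ suc)) (f≡0 zero λ ())) (∑-single (f ∘ suc) x₀ (λ x x≢x₀ → f≡0 (suc x) (x≢x₀ ∘ suc-injective)))

≤-∑ : ∀ {n} (f : Fin n → ℕ) x → f x ≤ sum f
≤-∑ f zero    = m≤m+n _ _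
≤-∑ f (suc x) = ≤-trans (≤-∑ (f ∘ suc) x) (m≤n+m _ _)

+-≤-∑ : ∀ {n} (f : Fin n → ℕ) {x y} → x ≢ y → f x + f y ≤ sum f
+-≤-∑ f {zero}  {zero}  x≢y = ⊥-elim (x≢y refl)
+-≤-∑ f {zero}  {suc y} _   = +-monoʳ-≤ (f zero) (≤-∑ (f ∘ suc) y)
+-≤-∑ f {suc x} {zero}  _   = subst (_≤ sum f) (+-comm (f zero) (f (suc x))) (+-monoʳ-≤ (f zero) (≤-∑ (f ∘ suc) x))
+-≤-∑ f {suc x} {suc y} x≢y = ≤-trans (+-≤-∑ (f ∘ suc) (x≢y ∘ cong suc)) (m≤n+m _ _)

∑-pos : ∀ {n} (f : Fin n → ℕ) → 0 < sum f → ∃[ x ] 0 < f x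
∑-pos {suc n} f 0<∑ with 0<m+n⇒0<m⊎0<n (f zero) 0<∑
... | inj₁ 0<f₀ = zero , 0<f₀
... | inj₂ 0<∑′ with ∑-pos (f ∘ suc) 0<∑′
...   | x , 0<fx = suc x , 0<fx

∑-≤1 : ∀ {n} {f : Fin n → ℕ} → (∀ x → f x ≤ 1) → (∀ {x y} → 0 < f x → 0 < f y → x ≡ y) → sum f ≤ 1
∑-≤1 {zero}  _   _    = z≤n
∑-≤1 {suc n} {f} f≤1 uniq = m+n≤1 (f≤1 zero) (∑-≤1 (f≤1 ∘ suc) (λ p q → suc-injective (uniq p q)))
  λ 0<f₀ 0<∑ → let (x , 0<fx) = ∑-pos (f ∘ suc) 0<∑ in 0≢1+n (uniq 0<f₀ 0<fx)

𝟙 : ∀ {p} {P : Set p} → Dec P → ℕ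
𝟙 (yes _) = 1
𝟙 (no _)  = 0

𝟙≤1 : ∀ {p} {P : Set p} (P? : Dec P) → 𝟙 P? ≤ 1
𝟙≤1 (yes _) = ≤-refl
𝟙≤1 (no _)  = z≤n

𝟙≡1 : ∀ {p} {P : Set p} (P? : Dec P) → P → 𝟙 P? ≡ 1
𝟙≡1 (yes _) _  = refl
𝟙≡1 (no ¬p) p = ⊥-elim (¬p p)

0<𝟙⇒P : ∀ {p} {P : Set p} (P? : Dec P) → 0 < 𝟙 P? → P
0<𝟙⇒P (yes p) _ = p

sumProducts : List (List ℕ) → ℕ
sumProducts yss = sumList (map product yss)

sumProducts-++ : ∀ xss yss → sumProducts (xss ++ yss) ≡ sumProducts xss + sumProducts yss
sumProducts-++ xss yss = trans (cong sumList (map-++ product xss yss)) (sum-++ (map product xss) _)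

sumProdChoose-zero : ∀ xs → sumProdChoose 0 xs ≡ 1
sumProdChoose-zero []       = refl
sumProdChoose-zero (x ∷ xs) = begin
  sumProducts (filterᵇ length≡0 (map (x ∷_) (sublists xs) ++ sublists xs))
    ≡⟨ cong sumProducts (filter-++ (T? ∘ length≡0) (map (x ∷_) (sublists xs)) (sublists xs)) ⟩
  sumProducts (filterᵇ length≡0 (map (x ∷_) (sublists xs)) ++ filterᵇ length≡0 (sublists xs))
    ≡⟨ cong (λ yss → sumProducts (yss ++ filterᵇ length≡0 (sublists xs))) (nonempty (sublists xs)) ⟩
  sumProdChoose 0 xs
    ≡⟨ sumProdChoose-zero xs ⟩
  1 ∎
  where
  open ≡-Reasoning
  length≡0 : List ℕ → Bool
  length≡0 ys = length ys ≡ᵇ 0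
  nonempty : ∀ yss → filterᵇ length≡0 (map (x ∷_) yss) ≡ []
  nonempty []        = refl
  nonempty (_ ∷ yss) = nonempty yss

sumProdChoose-∷ : ∀ t x xs → sumProdChoose (suc t) (x ∷ xs) ≡ x * sumProdChoose t xs + sumProdChoose (suc t) xs
sumProdChoose-∷ t x xs = begin
  sumProducts (filterᵇ length≡1+t (map (x ∷_) (sublists xs) ++ sublists xs))
    ≡⟨ cong sumProducts (filter-++ (T? ∘ length≡1+t) (map (x ∷_) (sublists xs)) (sublists xs)) ⟩
  sumProducts (filterᵇ length≡1+t (map (x ∷_) (sublists xs)) ++ filterᵇ length≡1+t (sublists xs))
    ≡⟨ sumProducts-++ (filterᵇ length≡1+t (map (x ∷_) (sublists xs))) _ ⟩
  sumProducts (filterᵇ length≡1+t (map (x ∷_) (sublists xs))) + sumProdChoose (suc t) xs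
    ≡⟨ cong (_+ sumProdChoose (suc t) xs) (cons-sum (sublists xs)) ⟩
  x * sumProdChoose t xs + sumProdChoose (suc t) xs ∎
  where
  open ≡-Reasoning
  length≡1+t : List ℕ → Bool
  length≡1+t ys = length ys ≡ᵇ suc t
  cons-sum : ∀ yss → sumProducts (filterᵇ length≡1+t (map (x ∷_) yss))
                   ≡ x * sumProducts (filterᵇ (λ ys → length ys ≡ᵇ t) yss)
  cons-sum []         = sym (*-zeroʳ x)
  cons-sum (ys ∷ yss) with length ys ≡ᵇ t
  ... | true  = trans (cong (x * product ys +_) (cons-sum yss)) (sym (*-distribˡ-+ x (product ys) _))
  ... | false = cons-sum yss

∣tabulate-false∣ : ∀ n → ∣ tabulateᵥ {n = n} (λ _ → false) ∣ ≡ 0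
∣tabulate-false∣ zero    = refl
∣tabulate-false∣ (suc n) = ∣tabulate-false∣ n

∣tabulate∣-insert : ∀ {n} (f g : Fin n → Bool) c → f c ≡ false → g c ≡ true → (∀ j → j ≢ c → g j ≡ f j) →
  ∣ tabulateᵥ g ∣ ≡ suc ∣ tabulateᵥ f ∣
∣tabulate∣-insert f g zero fc gc g≡f
  rewrite fc | gc | tabulate-cong (λ j → g≡f (suc j) λ ()) = refl
∣tabulate∣-insert f g (suc c) fc gc g≡f rewrite g≡f zero (λ ()) with f zero
... | true  = cong suc (∣tabulate∣-insert (f ∘ suc) (g ∘ suc) c fc gc λ j j≢c → g≡f (suc j) (j≢c ∘ suc-injective))
... | false = ∣tabulate∣-insert (f ∘ suc) (g ∘ suc) c fc gc λ j j≢c → g≡f (suc j) (j≢c ∘ suc-injective)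

module _ {k : ℕ} {v : Fin k → ℕ} where

  ∅ : PartialAssignment k v
  ∅ _ = nothing

  _[_]≔_ : PartialAssignment k v → (c : Fin k) → Fin (v c) → PartialAssignment k v
  (β [ c ]≔ x) j with j ≟ c
  ... | yes refl = just x
  ... | no _     = β j

  []≔-same : ∀ β c x → (β [ c ]≔ x) c ≡ just x
  []≔-same β c x with c ≟ c
  ... | yes refl = refl
  ... | no c≢c   = ⊥-elim (c≢c refl)

  []≔-other : ∀ β c x {j} → j ≢ c → (β [ c ]≔ x) j ≡ β j
  []≔-other β c x {j} j≢c with j ≟ c
  ... | yes refl = ⊥-elim (j≢c refl)
  ... | no _     = refl

  ∣support-[]≔∣ : ∀ β c x → β c ≡ nothing → ∣ support (β [ c ]≔ x) ∣ ≡ suc ∣ support β ∣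
  ∣support-[]≔∣ β c x βc≡nothing = ∣tabulate∣-insert (is-just ∘ β) (is-just ∘ (β [ c ]≔ x)) c
    (cong is-just βc≡nothing) (cong is-just ([]≔-same β c x)) (λ j j≢c → cong is-just ([]≔-other β c x j≢c))

  Unassigned : List (Fin k) → PartialAssignment k v → Set
  Unassigned cs β = All (λ c → β c ≡ nothing) cs

  Unassigned-[]≔ : ∀ {c cs} β x → All (c ≢_) cs → Unassigned cs β → Unassigned cs (β [ c ]≔ x)
  Unassigned-[]≔ β x []           []          = []
  Unassigned-[]≔ β x (c≢d ∷ c≢cs) (βd ∷ βcs) =
    trans ([]≔-other β _ x (c≢d ∘ sym)) βd ∷ Unassigned-[]≔ β x c≢cs βcs

  data Extension : ℕ → List (Fin k) → PartialAssignment k v → PartialAssignment k v → Set where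
    stop : ∀ {cs β} → Extension 0 cs β β
    take : ∀ {t c cs β T} x → Extension t cs (β [ c ]≔ x) T → Extension (suc t) (c ∷ cs) β T
    skip : ∀ {t c cs β T} → Extension (suc t) cs β T → Extension (suc t) (c ∷ cs) β T

  -- Interactions are summed over this tree of choices rather than over a list of them, which
  -- would need a decidable equality on partial assignments (functions).
  sumExtensions : ℕ → List (Fin k) → PartialAssignment k v → (PartialAssignment k v → ℕ) → ℕ
  sumExtensions zero    cs       β f = f β
  sumExtensions (suc t) []       β f = 0
  sumExtensions (suc t) (c ∷ cs) β f =
    ∑[ x < v c ] sumExtensions t cs (β [ c ]≔ x) f + sumExtensions (suc t) cs β f

  Extension-outside : ∀ {t cs β T j} → Extension t cs β T → All (j ≢_) cs → T j ≡ β j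
  Extension-outside stop               _            = refl
  Extension-outside (take {c = c} x e) (j≢c ∷ j∉cs) = trans (Extension-outside e j∉cs) ([]≔-other _ c x j≢c)
  Extension-outside (skip e)           (_ ∷ j∉cs)   = Extension-outside e j∉cs

  Extension-taken : ∀ {t c cs β T} x → Extension t cs (β [ c ]≔ x) T → All (c ≢_) cs → T c ≡ just x
  Extension-taken {β = β} x e c∉cs = trans (Extension-outside e c∉cs) ([]≔-same β _ x)

  ∣support∣-Extension : ∀ {t cs β T} → Unique cs → Unassigned cs β → Extension t cs β T →
    ∣ support T ∣ ≡ ∣ support β ∣ + t
  ∣support∣-Extension _            _          stop = sym (+-identityʳ _)
  ∣support∣-Extension (c∉cs ∷ cs!) (βc ∷ βcs) (take {t = t} {c = c} {β = β} {T = T} x e) = begin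
    ∣ support T ∣                   ≡⟨ ∣support∣-Extension cs! (Unassigned-[]≔ β x c∉cs βcs) e ⟩
    ∣ support (β [ c ]≔ x) ∣ + t    ≡⟨ cong (_+ t) (∣support-[]≔∣ β c x βc) ⟩
    suc ∣ support β ∣ + t           ≡⟨ +-suc _ t ⟨
    ∣ support β ∣ + suc t           ∎
    where open ≡-Reasoning
  ∣support∣-Extension (_ ∷ cs!)    (_ ∷ βcs)  (skip e) = ∣support∣-Extension cs! βcs e

  sumExtensions-mono-≤ : ∀ t cs β {f g : PartialAssignment k v → ℕ} →
    (∀ {T} → Extension t cs β T → f T ≤ g T) → sumExtensions t cs β f ≤ sumExtensions t cs β g
  sumExtensions-mono-≤ zero    cs       β f≤g = f≤g stop
  sumExtensions-mono-≤ (suc t) []       β f≤g = z≤n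
  sumExtensions-mono-≤ (suc t) (c ∷ cs) β f≤g =
    +-mono-≤ (∑-mono-≤ λ x → sumExtensions-mono-≤ t cs (β [ c ]≔ x) (f≤g ∘ take x))
             (sumExtensions-mono-≤ (suc t) cs β (f≤g ∘ skip))

  sumExtensions-distrib-+ : ∀ t cs β (f g : PartialAssignment k v → ℕ) →
    sumExtensions t cs β (λ T → f T + g T) ≡ sumExtensions t cs β f + sumExtensions t cs β g
  sumExtensions-distrib-+ zero    cs       β f g = refl
  sumExtensions-distrib-+ (suc t) []       β f g = refl
  sumExtensions-distrib-+ (suc t) (c ∷ cs) β f g = trans
    (cong₂ _+_ (trans (sum-cong-≗ λ x → sumExtensions-distrib-+ t cs (β [ c ]≔ x) f g)
                      (∑-distrib-+ (λ x → sumExtensions t cs (β [ c ]≔ x) f) (λ x → sumExtensions t cs (β [ c ]≔ x) g)))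
               (sumExtensions-distrib-+ (suc t) cs β f g))
    (interchange (∑[ x < v c ] sumExtensions t cs (β [ c ]≔ x) f) (∑[ x < v c ] sumExtensions t cs (β [ c ]≔ x) g)
                 (sumExtensions (suc t) cs β f) (sumExtensions (suc t) cs β g))

  sumExtensions-∑-comm : ∀ t cs β {m} (h : PartialAssignment k v → Fin m → ℕ) →
    sumExtensions t cs β (λ T → ∑[ r < m ] h T r) ≡ ∑[ r < m ] sumExtensions t cs β (λ T → h T r)
  sumExtensions-∑-comm zero    cs       β     h = refl
  sumExtensions-∑-comm (suc t) []       β {m} h = sym (sum-replicate-zero m)
  sumExtensions-∑-comm (suc t) (c ∷ cs) β     h = trans
    (cong₂ _+_ (trans (sum-cong-≗ λ x → sumExtensions-∑-comm t cs (β [ c ]≔ x) h)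
                      (∑-comm λ x r → sumExtensions t cs (β [ c ]≔ x) (λ T → h T r)))
               (sumExtensions-∑-comm (suc t) cs β h))
    (sym (∑-distrib-+ (λ r → ∑[ x < v c ] sumExtensions t cs (β [ c ]≔ x) (λ T → h T r))
                      (λ r → sumExtensions (suc t) cs β (λ T → h T r))))

  sumExtensions-pos : ∀ t cs β (f : PartialAssignment k v → ℕ) → 0 < sumExtensions t cs β f →
    ∃[ T ] Extension t cs β T × 0 < f T
  sumExtensions-pos zero    cs       β f 0<f = β , stop , 0<f
  sumExtensions-pos (suc t) (c ∷ cs) β f 0<s with 0<m+n⇒0<m⊎0<n _ 0<s
  ... | inj₁ 0<∑ with ∑-pos _ 0<∑
  ...   | x , 0<sx with sumExtensions-pos t cs (β [ c ]≔ x) f 0<sx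
  ...     | T , e , 0<fT = T , take x e , 0<fT
  sumExtensions-pos (suc t) (c ∷ cs) β f 0<s | inj₂ 0<s′ with sumExtensions-pos (suc t) cs β f 0<s′
  ...   | T , e , 0<fT = T , skip e , 0<fT

  sumExtensions-1 : ∀ t cs β → sumExtensions t cs β (λ _ → 1) ≡ sumProdChoose t (map v cs)
  sumExtensions-1 zero    cs       β = sym (sumProdChoose-zero (map v cs))
  sumExtensions-1 (suc t) []       β = refl
  sumExtensions-1 (suc t) (c ∷ cs) β = begin
    ∑[ x < v c ] sumExtensions t cs (β [ c ]≔ x) (λ _ → 1) + sumExtensions (suc t) cs β (λ _ → 1)
      ≡⟨ cong₂ _+_ (sum-cong-≗ λ x → sumExtensions-1 t cs (β [ c ]≔ x)) (sumExtensions-1 (suc t) cs β) ⟩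
    ∑[ x < v c ] sumProdChoose t (map v cs) + sumProdChoose (suc t) (map v cs)
      ≡⟨ cong (_+ sumProdChoose (suc t) (map v cs)) (∑-const (v c) _) ⟩
    v c * sumProdChoose t (map v cs) + sumProdChoose (suc t) (map v cs)
      ≡⟨ sumProdChoose-∷ t (v c) (map v cs) ⟨
    sumProdChoose (suc t) (map v (c ∷ cs)) ∎
    where open ≡-Reasoning

  Covers : ((j : Fin k) → Fin (v j)) → PartialAssignment k v → Set
  Covers a T = ∀ j x → T j ≡ just x → a j ≡ x

  covers? : ∀ a T → Dec (Covers a T)
  covers? a T = all? entry?
    where
    entry? : ∀ j → Dec (∀ x → T j ≡ just x → a j ≡ x)
    entry? j with T j
    ... | nothing = yes λ _ ()
    ... | just y with a j ≟ y
    ...   | yes aj≡y = yes λ { _ refl → aj≡y }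
    ...   | no aj≢y  = no λ h → aj≢y (h y refl)

  sumExtensions-covered≤C : ∀ a t cs β → Unique cs →
    sumExtensions t cs β (λ T → 𝟙 (covers? a T)) ≤ length cs C t
  sumExtensions-covered≤C a zero    cs       β _ = 𝟙≤1 (covers? a β)
  sumExtensions-covered≤C a (suc t) []       β _ = z≤n
  sumExtensions-covered≤C a (suc t) (c ∷ cs) β (c∉cs ∷ cs!) = begin
    ∑[ x < v c ] covered x + sumExtensions (suc t) cs β covers
      ≡⟨ cong (_+ sumExtensions (suc t) cs β covers) (∑-single covered (a c) others-vanish) ⟩
    covered (a c) + sumExtensions (suc t) cs β covers
      ≤⟨ +-mono-≤ (sumExtensions-covered≤C a t cs _ cs!) (sumExtensions-covered≤C a (suc t) cs β cs!) ⟩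
    length cs C t + length cs C suc t
      ≡⟨ nCk+nC[k+1]≡[n+1]C[k+1] (length cs) t ⟩
    suc (length cs) C suc t ∎
    where
    open ≤-Reasoning
    covers : PartialAssignment k v → ℕ
    covers T = 𝟙 (covers? a T)
    covered : Fin (v c) → ℕ
    covered x = sumExtensions t cs (β [ c ]≔ x) covers
    others-vanish : ∀ x → x ≢ a c → covered x ≡ 0
    others-vanish x x≢ac = n≤0⇒n≡0 (≮⇒≥ λ 0<covered →
      let (T , e , 0<covers) = sumExtensions-pos t cs _ covers 0<covered
      in x≢ac (sym (0<𝟙⇒P (covers? a T) 0<covers c x (Extension-taken x e c∉cs))))

  sumExtensions-≤1 : ∀ t cs β {P : PartialAssignment k v → Set} (P? : ∀ T → Dec (P T)) →
    Unique cs → Unassigned cs β →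
    (∀ {T T′} → Extension t cs β T → Extension t cs β T′ → P T → P T′ → ∀ j → T j ≡ T′ j) →
    sumExtensions t cs β (λ T → 𝟙 (P? T)) ≤ 1
  sumExtensions-≤1 zero    cs       β P? _ _ _ = 𝟙≤1 (P? β)
  sumExtensions-≤1 (suc t) []       β P? _ _ _ = z≤n
  sumExtensions-≤1 (suc t) (c ∷ cs) β {P} P? (c∉cs ∷ cs!) (βc ∷ βcs) P-unique =
    m+n≤1 (∑-≤1 taken≤1 taken-unique)
          (sumExtensions-≤1 (suc t) cs β P? cs! βcs λ e e′ → P-unique (skip e) (skip e′))
          taken-and-skipped
    where
    indicator : PartialAssignment k v → ℕ
    indicator T = 𝟙 (P? T)
    taken : Fin (v c) → ℕ
    taken x = sumExtensions t cs (β [ c ]≔ x) indicator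
    taken≤1 : ∀ x → taken x ≤ 1
    taken≤1 x = sumExtensions-≤1 t cs (β [ c ]≔ x) P? cs! (Unassigned-[]≔ β x c∉cs βcs)
      λ e e′ → P-unique (take x e) (take x e′)
    witness : ∀ x → 0 < taken x → ∃[ T ] T c ≡ just x × P T × Extension (suc t) (c ∷ cs) β T
    witness x 0<taken with sumExtensions-pos t cs (β [ c ]≔ x) indicator 0<taken
    ... | T , e , 0<𝟙 = T , Extension-taken x e c∉cs , 0<𝟙⇒P (P? T) 0<𝟙 , take x e
    taken-unique : ∀ {x y} → 0 < taken x → 0 < taken y → x ≡ y
    taken-unique {x} {y} 0<x 0<y with witness x 0<x | witness y 0<y
    ... | T , Tc , PT , e | T′ , T′c , PT′ , e′ =
      just-injective (trans (sym Tc) (trans (P-unique e e′ PT PT′ c) T′c))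
    taken-and-skipped : 0 < ∑[ x < v c ] taken x → 0 < sumExtensions (suc t) cs β indicator → ⊥
    taken-and-skipped 0<∑ 0<skipped with ∑-pos taken 0<∑
    ... | x , 0<x with witness x 0<x | sumExtensions-pos (suc t) cs β indicator 0<skipped
    ...   | T , Tc , PT , e | T′ , e′ , 0<𝟙 with P-unique e (skip e′) PT (0<𝟙⇒P (P? T′) 0<𝟙) c
    ...     | Tc≡T′c with trans (sym Tc) (trans Tc≡T′c (trans (Extension-outside e′ c∉cs) βc))
    ...       | ()

  Extension-∅-isInteraction : ∀ {t cs T} → Unique cs → Extension t cs ∅ T → IsInteraction t T
  Extension-∅-isInteraction {t} cs! e =
    trans (∣support∣-Extension cs! (universal (λ _ → refl) _) e) (cong (_+ t) (∣tabulate-false∣ k))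

module _ {N k : ℕ} {v : Fin k → ℕ} (A : Array N k v) where

  coverage : PartialAssignment k v → ℕ
  coverage T = ∑[ r < N ] 𝟙 (covers? (A r) T)

  UniquelyCovers : Fin N → PartialAssignment k v → Set
  UniquelyCovers r T = InRho A T r × coverage T ≡ 1

  uniquelyCovers? : ∀ r T → Dec (UniquelyCovers r T)
  uniquelyCovers? r T = covers? (A r) T ×-dec (coverage T ℕ.≟ 1)

  weight : Fin N → PartialAssignment k v → ℕ
  weight r T = 𝟙 (covers? (A r) T) + 𝟙 (uniquelyCovers? r T)

  0<coverage : ∀ {T} r → InRho A T r → 0 < coverage T
  0<coverage {T} r ρr = ≤-trans (≤-reflexive (sym (𝟙≡1 (covers? (A r) T) ρr))) (≤-∑ _ r)

  coverage≡1⇒unique-row : ∀ {T r r′} → coverage T ≡ 1 → InRho A T r → InRho A T r′ → r′ ≡ r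
  coverage≡1⇒unique-row {T} {r} {r′} c≡1 ρr ρr′ with r′ ≟ r
  ... | yes r′≡r = r′≡r
  ... | no r′≢r  = ⊥-elim (1+n≰n (begin
    2                                                ≡⟨ cong₂ _+_ (𝟙≡1 (covers? (A r′) T) ρr′) (𝟙≡1 (covers? (A r) T) ρr) ⟨
    𝟙 (covers? (A r′) T) + 𝟙 (covers? (A r) T)     ≤⟨ +-≤-∑ (λ r → 𝟙 (covers? (A r) T)) r′≢r ⟩
    coverage T                                       ≡⟨ c≡1 ⟩
    1                                                ∎))
    where open ≤-Reasoning

  coverage≡1⇒𝟙-uniquelyCovers : ∀ {T} → coverage T ≡ 1 → ∀ r → 𝟙 (uniquelyCovers? r T) ≡ 𝟙 (covers? (A r) T)
  coverage≡1⇒𝟙-uniquelyCovers {T} c≡1 r with covers? (A r) T | uniquelyCovers? r T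
  ... | yes _  | yes _       = refl
  ... | no _   | no _        = refl
  ... | yes ρr | no ¬u       = ⊥-elim (¬u (ρr , c≡1))
  ... | no ¬ρr | yes (ρr , _) = ⊥-elim (¬ρr ρr)

  module _ {t : ℕ} (LA : IsLA1bar t N k v A) where

    coverage-pos : ∀ {T} → IsInteraction t T → 0 < coverage T
    coverage-pos {T} T-int = n≢0⇒n>0 λ c≡0 →
      proj₁ (LA (just T) nothing T-int tt) λ r → (λ ρr → 1+n≰n (subst (0 <_) c≡0 (0<coverage r ρr))) , λ ()

    uniquelyCovers-unique : ∀ {r T T′} → IsInteraction t T → IsInteraction t T′ →
      UniquelyCovers r T → UniquelyCovers r T′ → ∀ j → T j ≡ T′ j
    uniquelyCovers-unique {T = T} {T′} T-int T′-int (ρr , c≡1) (ρ′r , c′≡1) =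
      proj₁ (LA (just T) (just T′) T-int T′-int) λ r′ →
        (λ ρr′ → subst (InRho A T′) (sym (coverage≡1⇒unique-row c≡1 ρr ρr′)) ρ′r) ,
        (λ ρ′r′ → subst (InRho A T) (sym (coverage≡1⇒unique-row c′≡1 ρ′r ρ′r′)) ρr)

    2≤∑weight : ∀ {T} → IsInteraction t T → 2 ≤ ∑[ r < N ] weight r T
    2≤∑weight {T} T-int rewrite ∑-distrib-+ (λ r → 𝟙 (covers? (A r) T)) (λ r → 𝟙 (uniquelyCovers? r T))
      with m≤n⇒m<n∨m≡n (coverage-pos T-int)
    ... | inj₁ 1<c = ≤-trans 1<c (m≤m+n _ _)
    ... | inj₂ 1≡c = begin
      1 + 1                                          ≡⟨ cong₂ _+_ 1≡c (trans 1≡c (sym (sum-cong-≗ (coverage≡1⇒𝟙-uniquelyCovers (sym 1≡c))))) ⟩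
      coverage T + ∑[ r < N ] 𝟙 (uniquelyCovers? r T) ∎
      where open ≤-Reasoning

    sumExtensions-weight≤ : ∀ {cs} r → Unique cs → sumExtensions t cs ∅ (weight r) ≤ length cs C t + 1
    sumExtensions-weight≤ {cs} r cs! = begin
      sumExtensions t cs ∅ (weight r)
        ≡⟨ sumExtensions-distrib-+ t cs ∅ (λ T → 𝟙 (covers? (A r) T)) (λ T → 𝟙 (uniquelyCovers? r T)) ⟩
      sumExtensions t cs ∅ (λ T → 𝟙 (covers? (A r) T)) + sumExtensions t cs ∅ (λ T → 𝟙 (uniquelyCovers? r T))
        ≤⟨ +-mono-≤ (sumExtensions-covered≤C (A r) t cs ∅ cs!)
                    (sumExtensions-≤1 t cs ∅ (uniquelyCovers? r) cs! (universal (λ _ → refl) cs) λ e e′ →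
                      uniquelyCovers-unique (Extension-∅-isInteraction cs! e) (Extension-∅-isInteraction cs! e′)) ⟩
      length cs C t + 1 ∎
      where open ≤-Reasoning

    2*sumProdChoose≤ : ∀ {cs} → Unique cs → 2 * sumProdChoose t (map v cs) ≤ N * suc (length cs C t)
    2*sumProdChoose≤ {cs} cs! = begin
      2 * S                                                  ≡⟨ cong (S +_) (+-identityʳ S) ⟩
      S + S                                                  ≡⟨ cong₂ _+_ (sumExtensions-1 t cs ∅) (sumExtensions-1 t cs ∅) ⟨
      sumExtensions t cs ∅ (λ _ → 1) + sumExtensions t cs ∅ (λ _ → 1)
                                                             ≡⟨ sumExtensions-distrib-+ t cs ∅ (λ _ → 1) (λ _ → 1) ⟨
      sumExtensions t cs ∅ (λ _ → 2)                         ≤⟨ sumExtensions-mono-≤ t cs ∅ (2≤∑weight ∘ Extension-∅-isInteraction cs!) ⟩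
      sumExtensions t cs ∅ (λ T → ∑[ r < N ] weight r T)     ≡⟨ sumExtensions-∑-comm t cs ∅ (λ T r → weight r T) ⟩
      ∑[ r < N ] sumExtensions t cs ∅ (weight r)             ≤⟨ ∑-mono-≤ (λ r → sumExtensions-weight≤ r cs!) ⟩
      ∑[ r < N ] (length cs C t + 1)                         ≡⟨ ∑-const N (length cs C t + 1) ⟩
      N * (length cs C t + 1)                                ≡⟨ cong (N *_) (+-comm (length cs C t) 1) ⟩
      N * suc (length cs C t)                                ∎
      where
      open ≤-Reasoning
      S = sumProdChoose t (map v cs)

a≤n*[1+b]⇒⌈a/1+b⌉≤n : ∀ a b n → a ≤ n * suc b → ⌈ a /suc b ⌉ ≤ n
a≤n*[1+b]⇒⌈a/1+b⌉≤n a b n a≤n*[1+b] = ≤-pred (m<n*o⇒m/o<n {a + b} {suc n} {suc b} (s≤s (begin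
  a + b          ≤⟨ +-monoˡ-≤ b a≤n*[1+b] ⟩
  n * suc b + b  ≡⟨ +-comm (n * suc b) b ⟩
  b + n * suc b  ∎)))
  where open ≤-Reasoning

i∸o≡1+[i∸1+o] : ∀ {i o} → o < i → i ∸ o ≡ suc (i ∸ suc o)
i∸o≡1+[i∸1+o] {suc i} {zero}  _         = refl
i∸o≡1+[i∸1+o] {suc i} {suc o} (s≤s o<i) = i∸o≡1+[i∸1+o] o<i

length-filter-≤ᵇ-tabulate : ∀ i o {m n} (f : Fin m → Fin n) → (∀ j → toℕ (f j) ≡ toℕ j + o) →
  length (filterᵇ (λ j → i ≤ᵇ toℕ j) (tabulate f)) ≡ m ∸ (i ∸ o)
length-filter-≤ᵇ-tabulate i o {zero}  f f≡ = sym (0∸n≡0 (i ∸ o))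
length-filter-≤ᵇ-tabulate i o {suc m} f f≡
  with IH ← length-filter-≤ᵇ-tabulate i (suc o) (f ∘ suc) (λ j → trans (f≡ (suc j)) (sym (+-suc (toℕ j) o)))
  rewrite f≡ zero
  with i ≤ᵇ o | ≤ᵇ-reflects-≤ i o
... | true  | ofʸ i≤o = trans (cong suc (trans IH (cong (m ∸_) (m≤n⇒m∸n≡0 (m≤n⇒m≤1+n i≤o)))))
                              (cong (suc m ∸_) (sym (m≤n⇒m∸n≡0 i≤o)))
... | false | ofⁿ i≰o = trans IH (cong (suc m ∸_) (sym (i∸o≡1+[i∸1+o] (≰⇒> i≰o))))

-- The argument needs none of the hypotheses on t, v or the position of i.
lemma3p2 : (k t : ℕ) → 0 < t → t < k →
    (v : Fin k → ℕ) →
    (∀ j → 2 ≤ v j) →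
    (∀ j j′ → toℕ j ≤ toℕ j′ → v j ≤ v j′) →
    (i : Fin k) → toℕ i + t < k →
    (∀ j → toℕ i ≤ toℕ j → toℕ j ≤ k ∸ t → v j ≡ v i) →
    (N : ℕ) (A : Array N k v) → IsLA1bar t N k v A →
    ⌈ 2 * sumProdChoose t (valuesFrom v (toℕ i)) /suc ((k ∸ toℕ i) C t) ⌉ ≤ N
lemma3p2 k t _ _ v _ _ i _ _ N A LA = a≤n*[1+b]⇒⌈a/1+b⌉≤n _ _ N
  (subst (λ n → 2 * sumProdChoose t (map v columns) ≤ N * suc (n C t)) length-columns
         (2*sumProdChoose≤ A LA columns-unique))
  where
  columns : List (Fin k)
  columns = filterᵇ (λ j → toℕ i ≤ᵇ toℕ j) (allFin k)
  columns-unique : Unique columns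
  columns-unique = filter⁺ (λ j → T? (toℕ i ≤ᵇ toℕ j)) (allFin⁺ k)
  length-columns : length columns ≡ k ∸ toℕ i
  length-columns = length-filter-≤ᵇ-tabulate (toℕ i) 0 (λ j → j) (λ j → sym (+-identityʳ (toℕ j)))
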